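{- Let $k\ge2$ be an integer and $q=p^r$ with $p$ prime and $r\ge1$. For $n\ge k$ let $\sigma_{n,k}\in\mathbb{F}_q[X_1,\dots,X_n]$ denote the elementary symmetric polynomial of degree $k$ in $n$ variables. Then the sequence $\{S_{\mathbb{F}_q}(\sigma_{n,k})\}$ satisfies a linear recurrence with constant coefficients.
   Context: For $F\in\mathbb{F}_q[X_1,\dots,X_n]$, $S_{\mathbb{F}_q}(F)=\sum_{\mathbf{x}\in\mathbb{F}_q^n}e^{\frac{2\pi i}{p}\mathrm{Tr}_{\mathbb{F}_q/\mathbb{F}_p}(F(\mathbf{x}))}$, with $\mathrm{Tr}_{\mathbb{F}_q/\mathbb{F}_p}$ the field trace. -}

module Defs where

open import Level using (Level; _⊔_) renaming (suc to lsuc)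
open import Data.Nat using (ℕ; zero; suc; _^_; _%_; _≡ᵇ_; NonZero)
import Data.Nat as N
open import Data.Fin using (Fin; toℕ)
open import Data.List using (List; []; _∷_; length; filter; map; concatMap; foldr; allFin)
open import Data.List.Relation.Unary.Any using (Any)
open import Data.List.Relation.Unary.AllPairs using (AllPairs)
open import Data.Vec using (Vec; []; _∷_)
open import Data.Product using (∃)
open import Data.Bool using (if_then_else_)
open import Data.Integer using (+_)
open import Data.Rational using (ℚ; 0ℚ; _/_) renaming (_+_ to _+ℚ_; _*_ to _*ℚ_)
open import Relation.Nullary using (¬_)
open import Relation.Binary using (Decidable)
open import Relation.Binary.PropositionalEquality using (_≡_)
open import Algebra.Bundles using (CommutativeRing)

record FiniteField (c ℓ : Level) : Set (lsuc (c ⊔ ℓ)) where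
  field
    commRing : CommutativeRing c ℓ
  open CommutativeRing commRing public
  field
    _≟F_     : Decidable _≈_
    0≉1      : ¬ (0# ≈ 1#)
    inverse  : ∀ x → ¬ (x ≈ 0#) → ∃ λ y → (x * y) ≈ 1#
    elems    : List Carrier
    complete : ∀ x → Any (x ≈_) elems
    distinct : AllPairs (λ a b → ¬ (a ≈ b)) elems

  card : ℕ
  card = length elems

  pow : Carrier → ℕ → Carrier
  pow x zero    = 1#
  pow x (suc n) = x * pow x n

  fromℕ : ℕ → Carrier
  fromℕ zero    = 0#
  fromℕ (suc m) = 1# + fromℕ m

  trace : (p r : ℕ) → Carrier → Carrier
  trace p zero    y = 0#
  trace p (suc j) y = trace p j y + pow y (p ^ j)

  points : (n : ℕ) → List (Vec Carrier n)
  points zero    = [] ∷ []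
  points (suc n) = concatMap (λ a → map (a ∷_) (points n)) elems

  esym : (k : ℕ) → {n : ℕ} → Vec Carrier n → Carrier
  esym zero    xs       = 1#
  esym (suc k) []       = 0#
  esym (suc k) (x ∷ xs) = esym (suc k) xs + x * esym k xs

  countTr : (p r n : ℕ) → (Vec Carrier n → Carrier) → ℕ → ℕ
  countTr p r n F m =
    length (filter (λ x → trace p r (F x) ≟F fromℕ m) (points n))

-- The cyclotomic field ℚ(ζ_p), ζ_p = e^{2πi/p}, p prime.
-- An element is represented by a coefficient vector a : Fin p → ℚ,
-- standing for Σ_m a m · ζ_p^m.

Cyc : ℕ → Set
Cyc p = Fin p → ℚ

-- Σ_m a m ζ^m = Σ_m b m ζ^m in ℂ  iff  a - b is a constant vector
-- (the only ℚ-linear relation among 1, ζ, …, ζ^(p-1) for p prime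
--  is 1 + ζ + … + ζ^(p-1) = 0).
_≃C_ : {p : ℕ} → Cyc p → Cyc p → Set
_≃C_ a b = ∃ λ (c : ℚ) → ∀ i → a i ≡ b i +ℚ c

sumFin : {p : ℕ} → (Fin p → ℚ) → ℚ
sumFin {p} f = foldr (λ i acc → f i +ℚ acc) 0ℚ (allFin p)

_+C_ : {p : ℕ} → Cyc p → Cyc p → Cyc p
(a +C b) i = a i +ℚ b i

zeroC : {p : ℕ} → Cyc p
zeroC i = 0ℚ

-- product: ζ^i · ζ^j = ζ^((i + j) mod p)
mulC : (p : ℕ) → .{{_ : NonZero p}} → Cyc p → Cyc p → Cyc p
mulC p a b m = sumFin (λ i → sumFin (λ j →
  if ((toℕ i N.+ toℕ j) % p) ≡ᵇ toℕ m then a i *ℚ b j else 0ℚ))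

sumC : {p d : ℕ} → (Fin d → Cyc p) → Cyc p
sumC {p} {d} f = foldr (λ i acc → f i +C acc) zeroC (allFin d)

-- The exponential sum S_{F_q}(F) = Σ_{x ∈ F_q^n} e^{2πi Tr(F(x))/p}
-- = Σ_{m < p} N_m(F) ζ_p^m, as an element of ℚ(ζ_p).

expSum : ∀ {c ℓ} (K : FiniteField c ℓ) (p r n : ℕ) →
         (Vec (FiniteField.Carrier K) n → FiniteField.Carrier K) → Cyc p
expSum K p r n F m = (+ FiniteField.countTr K p r n F (toℕ m)) / 1

Sσ : ∀ {c ℓ} (K : FiniteField c ℓ) (p r k n : ℕ) → Cyc p
Sσ K p r k n = expSum K p r n (FiniteField.esym K k)

module Submission where

-- Record a point x ∈ F_q^n by its state (σ_k(x), …, σ_1(x), 1) ∈ F_q^(k+1). Adjoining a coordinate a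
-- changes the state by a map depending only on a, so the census vector, which counts the points of
-- F_q^n in each state, evolves by a fixed integer matrix. With D = q^(k+1) states, its first D + 1
-- values in ℤ^D are linearly dependent, the matrix carries the relation to all n, and each count
-- N_m(n) = #{x : Tr σ_k(x) = m} is a linear functional of the census, so it inherits the relation.
-- Dividing by the nonzero top coefficient gives a monic recurrence over ℚ for
-- S(σ_{n,k}) = Σ_m N_m(n) ζ_p^m.

module OrbitRecurrence where

  open import Data.Nat as ℕ using (ℕ; zero; suc; z≤n; s≤s)
  import Data.Nat.Properties as ℕP
  open import Data.Integer using (ℤ; 0ℤ; 1ℤ; _+_; _*_; -_; _-_)
  import Data.Integer.Properties as ℤP
  open import Data.Integer.Tactic.RingSolver using (solve-∀)
  open import Data.Fin using (Fin; zero; suc; toℕ; punchIn)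
  import Data.Fin.Properties as FinP
  open import Data.Vec.Functional using (insertAt; removeAt)
  open import Data.Vec.Functional.Properties using (insertAt-lookup; insertAt-punchIn)
  open import Data.Product using (Σ; ∃; _,_; _×_)
  open import Data.Sum using (inj₁; inj₂)
  open import Function using (_∘_)
  open import Relation.Nullary using (yes; no; contradiction)
  open import Relation.Binary.PropositionalEquality
  open import Algebra.Properties.Semiring.Sum ℤP.+-*-semiring
    using ( sum-syntax; sum-cong-≗; ∑-distrib-+; ∑-comm; sum-remove; sum-init-last
          ; *-distribˡ-sum; sum-replicate-zero)
  open ≡-Reasoning

  lincomb : ∀ {N D} → (Fin N → ℤ) → (Fin N → Fin D → ℤ) → Fin D → ℤ
  lincomb {N} a w t = ∑[ i < N ] (a i * w i t)

  LinearlyDependent : ∀ {N D} → (Fin N → Fin D → ℤ) → Set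
  LinearlyDependent w = ∃ λ a → (∃ λ i → a i ≢ 0ℤ) × (∀ t → lincomb a w t ≡ 0ℤ)

  ∑-linear : ∀ {N} (a x y : Fin N → ℤ) c d →
    ∑[ i < N ] (a i * (c * x i + d * y i)) ≡ c * ∑[ i < N ] (a i * x i) + d * ∑[ i < N ] (a i * y i)
  ∑-linear {N} a x y c d = begin
    ∑[ i < N ] (a i * (c * x i + d * y i))
      ≡⟨ sum-cong-≗ (λ i → distrib (a i) c (x i) d (y i)) ⟩
    ∑[ i < N ] (c * (a i * x i) + d * (a i * y i))
      ≡⟨ ∑-distrib-+ {N} _ _ ⟩
    ∑[ i < N ] (c * (a i * x i)) + ∑[ i < N ] (d * (a i * y i))
      ≡⟨ sym (cong₂ _+_ (*-distribˡ-sum {N} c _) (*-distribˡ-sum {N} d _)) ⟩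
    c * ∑[ i < N ] (a i * x i) + d * ∑[ i < N ] (a i * y i) ∎
    where
    distrib : ∀ aᵢ c xᵢ d yᵢ → aᵢ * (c * xᵢ + d * yᵢ) ≡ c * (aᵢ * xᵢ) + d * (aᵢ * yᵢ)
    distrib = solve-∀

  lincomb-insertAt : ∀ {N D} (b : Fin N → ℤ) j z (w : Fin (suc N) → Fin D → ℤ) t →
    lincomb (insertAt b j z) w t ≡ z * w j t + lincomb b (removeAt w j) t
  lincomb-insertAt b j z w t = begin
    lincomb (insertAt b j z) w t
      ≡⟨ sum-remove {i = j} (λ i → insertAt b j z i * w i t) ⟩
    insertAt b j z j * w j t + ∑[ i < _ ] (insertAt b j z (punchIn j i) * w (punchIn j i) t)
      ≡⟨ cong₂ _+_ (cong (_* w j t) (insertAt-lookup b j z))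
                   (sum-cong-≗ λ i → cong (_* w (punchIn j i) t) (insertAt-punchIn b j z i)) ⟩
    z * w j t + lincomb b (removeAt w j) t ∎

  *-≢0 : ∀ {i j} → i ≢ 0ℤ → j ≢ 0ℤ → i * j ≢ 0ℤ
  *-≢0 {i} i≢0 j≢0 ij≡0 with ℤP.i*j≡0⇒i≡0∨j≡0 i ij≡0
  ... | inj₁ i≡0 = i≢0 i≡0
  ... | inj₂ j≡0 = j≢0 j≡0

  dependent-from-tails : ∀ {N D} (w : Fin N → Fin (suc D) → ℤ) → (∀ i → w i zero ≡ 0ℤ) →
    LinearlyDependent (λ i → w i ∘ suc) → LinearlyDependent w
  dependent-from-tails {N} w column₀≡0 (a , a≢0 , rel) = a , a≢0 , λ
    { zero → trans (sum-cong-≗ λ i → trans (cong (a i *_) (column₀≡0 i)) (ℤP.*-zeroʳ (a i)))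
                   (sum-replicate-zero N)
    ; (suc t) → rel t }

  -- Gaussian elimination of the first coordinate with pivot vector j.
  eliminate : ∀ {N D} → (Fin (suc N) → Fin (suc D) → ℤ) → Fin (suc N) → Fin N → Fin D → ℤ
  eliminate w j i t = w j zero * w (punchIn j i) (suc t) - w (punchIn j i) zero * w j (suc t)

  dependent-from-eliminated : ∀ {N D} (w : Fin (suc N) → Fin (suc D) → ℤ) j →
    w j zero ≢ 0ℤ → LinearlyDependent (eliminate w j) → LinearlyDependent w
  dependent-from-eliminated {N} {D} w j c≢0 (b , (i , bᵢ≢0) , rel) = a , (punchIn j i , aᵢ≢0) , rel′
    where
    c : ℤ
    c = w j zero
    w′ : Fin N → Fin (suc D) → ℤ
    w′ = removeAt w j
    S : ℤ
    S = lincomb b w′ zero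
    a : Fin (suc N) → ℤ
    a = insertAt (λ i → b i * c) j (- S)

    aᵢ≢0 : a (punchIn j i) ≢ 0ℤ
    aᵢ≢0 aᵢ≡0 = *-≢0 bᵢ≢0 c≢0 (trans (sym (insertAt-punchIn _ j (- S) i)) aᵢ≡0)

    expand : ∀ t → lincomb a w t ≡ - S * w j t + c * lincomb b w′ t
    expand t = trans (lincomb-insertAt _ j (- S) w t) (cong (- S * w j t +_) (begin
      ∑[ i < N ] (b i * c * w′ i t)   ≡⟨ sum-cong-≗ (λ i → swap (b i) c (w′ i t)) ⟩
      ∑[ i < N ] (c * (b i * w′ i t)) ≡⟨ *-distribˡ-sum {N} c _ ⟨
      c * lincomb b w′ t              ∎))
      where
      swap : ∀ x y z → x * y * z ≡ y * (x * z)
      swap = solve-∀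

    rel′ : ∀ t → lincomb a w t ≡ 0ℤ
    rel′ zero = trans (expand zero) (cancel S c)
      where
      cancel : ∀ S c → - S * c + c * S ≡ 0ℤ
      cancel = solve-∀
    rel′ (suc t) = begin
      lincomb a w (suc t)                                           ≡⟨ expand (suc t) ⟩
      - S * e + c * lincomb b w′ (suc t)                            ≡⟨ reorder S e _ ⟩
      c * lincomb b w′ (suc t) + - e * S                            ≡⟨ ∑-linear b _ _ c (- e) ⟨
      ∑[ i < N ] (b i * (c * w′ i (suc t) + - e * w′ i zero))
                                                                    ≡⟨ sum-cong-≗ (λ i → cong (b i *_) (sub c _ e _)) ⟩
      lincomb b (eliminate w j) t                                   ≡⟨ rel t ⟩
      0ℤ                                                            ∎
      where
      e : ℤ
      e = w j (suc t)
      reorder : ∀ S e x → - S * e + x ≡ x + - e * S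
      reorder = solve-∀
      sub : ∀ c x e y → c * x + - e * y ≡ c * x - y * e
      sub = solve-∀

  D<N⇒dependent : ∀ {N D} → D ℕ.< N → (w : Fin N → Fin D → ℤ) → LinearlyDependent w
  D<N⇒dependent {suc N} {zero} _ w = (λ _ → 1ℤ) , (zero , λ ()) , λ ()
  D<N⇒dependent {suc N} {suc D} (s≤s D<N) w with FinP.all? (λ i → w i zero ℤP.≟ 0ℤ)
  ... | yes column₀≡0 =
    dependent-from-tails w column₀≡0 (D<N⇒dependent (ℕP.m≤n⇒m≤1+n D<N) (λ i → w i ∘ suc))
  ... | no column₀≢0 with FinP.¬∀⟶∃¬ _ _ (λ i → w i zero ℤP.≟ 0ℤ) column₀≢0
  ...   | j , c≢0 = dependent-from-eliminated w j c≢0 (D<N⇒dependent D<N (eliminate w j))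

  sumTo : ℕ → (ℕ → ℤ) → ℤ
  sumTo n f = ∑[ i < n ] f (toℕ i)

  sumTo-suc : ∀ n f → sumTo (suc n) f ≡ sumTo n f + f n
  sumTo-suc n f = trans (sum-init-last {n} (f ∘ toℕ))
    (cong₂ _+_ (sum-cong-≗ {n} (cong f ∘ FinP.toℕ-inject₁)) (cong f (FinP.toℕ-fromℕ n)))

  Annihilates : ℕ → (ℕ → ℤ) → (ℕ → ℤ) → Set
  Annihilates j a x = ∀ n → sumTo (suc j) (λ i → a i * x (n ℕ.+ i)) ≡ 0ℤ

  padZero : ∀ {N} → (Fin N → ℤ) → ℕ → ℤ
  padZero {zero}  a m       = 0ℤ
  padZero {suc N} a zero    = a zero
  padZero {suc N} a (suc m) = padZero (a ∘ suc) m

  padZero-toℕ : ∀ {N} (a : Fin N → ℤ) i → padZero a (toℕ i) ≡ a i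
  padZero-toℕ a zero    = refl
  padZero-toℕ a (suc i) = padZero-toℕ (a ∘ suc) i

  linear-relation-map : ∀ N {D} (a : ℕ → ℤ) (x : ℕ → Fin D → ℤ) (L : Fin D → ℤ) →
    (∀ t → sumTo N (λ i → a i * x i t) ≡ 0ℤ) →
    sumTo N (λ i → a i * ∑[ t < D ] (L t * x i t)) ≡ 0ℤ
  linear-relation-map N {D} a x L rel = begin
    sumTo N (λ i → a i * ∑[ t < D ] (L t * x i t))
      ≡⟨ sum-cong-≗ {N} (λ i → trans (*-distribˡ-sum {D} (a (toℕ i)) _)
                                 (sum-cong-≗ {D} λ t → swap (a (toℕ i)) (L t) (x (toℕ i) t))) ⟩
    ∑[ i < N ] ∑[ t < D ] (L t * (a (toℕ i) * x (toℕ i) t))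
      ≡⟨ ∑-comm {N} {D} _ ⟩
    ∑[ t < D ] ∑[ i < N ] (L t * (a (toℕ i) * x (toℕ i) t))
      ≡⟨ sum-cong-≗ {D} (λ t → trans (sym (*-distribˡ-sum {N} (L t) _))
                                     (trans (cong (L t *_) (rel t)) (ℤP.*-zeroʳ (L t)))) ⟩
    ∑[ t < D ] 0ℤ
      ≡⟨ sum-replicate-zero D ⟩
    0ℤ ∎
    where
    swap : ∀ a l x → a * (l * x) ≡ l * (a * x)
    swap = solve-∀

  trim-top-zeros : ∀ D (a : ℕ → ℤ) {I : Set} (y : I → ℕ → ℤ) {i} → i ℕ.≤ D → a i ≢ 0ℤ →
    (∀ e → sumTo (suc D) (λ l → a l * y e l) ≡ 0ℤ) →
    ∃ λ j → a j ≢ 0ℤ × (∀ e → sumTo (suc j) (λ l → a l * y e l) ≡ 0ℤ)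
  trim-top-zeros D a y i≤D aᵢ≢0 rel with a D ℤP.≟ 0ℤ
  ... | no a_D≢0 = D , a_D≢0 , rel
  trim-top-zeros zero    a y z≤n aᵢ≢0 rel | yes a₀≡0 = contradiction a₀≡0 aᵢ≢0
  trim-top-zeros (suc D) a {I} y {i} i≤1+D aᵢ≢0 rel | yes a_D≡0 =
    trim-top-zeros D a y i≤D aᵢ≢0 λ e → begin
      sumTo (suc D) (term e)                            ≡⟨ ℤP.+-identityʳ _ ⟨
      sumTo (suc D) (term e) + 0ℤ                       ≡⟨ cong (sumTo (suc D) (term e) +_) last≡0 ⟨
      sumTo (suc D) (term e) + a (suc D) * y e (suc D)  ≡⟨ sumTo-suc (suc D) (term e) ⟨
      sumTo (suc (suc D)) (term e)                      ≡⟨ rel e ⟩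
      0ℤ                                                ∎
    where
    term : I → ℕ → ℤ
    term e l = a l * y e l
    i≤D : i ℕ.≤ D
    i≤D = ℕ.s≤s⁻¹ (ℕP.≤∧≢⇒< i≤1+D λ { refl → aᵢ≢0 a_D≡0 })
    last≡0 : ∀ {e} → a (suc D) * y e (suc D) ≡ 0ℤ
    last≡0 {e} = trans (cong (_* y e (suc D)) a_D≡0) (ℤP.*-zeroˡ (y e (suc D)))

  orbit-annihilated : ∀ {D} (A : Fin D → Fin D → ℤ) (v : ℕ → Fin D → ℤ) →
    (∀ n t → v (suc n) t ≡ ∑[ s < D ] (A t s * v n s)) →
    ∃ λ j → Σ (ℕ → ℤ) λ a → a j ≢ 0ℤ ×
      (∀ (L : Fin D → ℤ) → Annihilates j a (λ n → ∑[ t < D ] (L t * v n t)))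
  orbit-annihilated {D} A v step with D<N⇒dependent (ℕP.n<1+n D) (v ∘ toℕ)
  ... | b , (i , bᵢ≢0) , rel₀
    with trim-top-zeros D (padZero b) (λ t l → v l t) (ℕ.s≤s⁻¹ (FinP.toℕ<n i))
           (bᵢ≢0 ∘ trans (sym (padZero-toℕ b i)))
           (λ t → trans (sum-cong-≗ {suc D} λ l → cong (_* v (toℕ l) t) (padZero-toℕ b l)) (rel₀ t))
  ... | j , aⱼ≢0 , rel = j , padZero b , aⱼ≢0 , λ L n →
          linear-relation-map (suc j) (padZero b) (λ l → v (n ℕ.+ l)) L (relation n)
    where
    relation : ∀ n t → sumTo (suc j) (λ l → padZero b l * v (n ℕ.+ l) t) ≡ 0ℤ
    relation zero    = rel
    relation (suc n) t =
      trans (sum-cong-≗ {suc j} λ l → cong (padZero b (toℕ l) *_) (step (n ℕ.+ toℕ l) t))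
            (linear-relation-map (suc j) (padZero b) (λ l → v (n ℕ.+ l)) (A t) (relation n))

module PointCensus where

  open OrbitRecurrence
  open import Defs
  open import Level using (_⊔_)
  open import Data.Nat as ℕ using (ℕ; zero; suc)
  open import Data.Integer using (ℤ; 0ℤ; 1ℤ; _+_; _*_) renaming (+_ to ⁺_)
  import Data.Integer.Properties as ℤP
  open import Data.Fin using (Fin; toℕ)
  open import Data.List using (List; []; _∷_; length; filter; map; concatMap; lookup; _++_)
  open import Data.List.Relation.Unary.Any using (Any; here; there)
  open import Data.List.Relation.Unary.All as All using (All; _∷_)
  open import Data.List.Relation.Unary.AllPairs using (AllPairs; _∷_)
  open import Data.Vec using (Vec; []; _∷_; head)
  open import Data.Vec.Relation.Binary.Pointwise.Inductive as Pointwise using (Pointwise; []; _∷_)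
  open import Data.Product using (Σ; ∃; _,_; _×_)
  open import Function using (_∘_)
  open import Relation.Nullary using (¬_; Dec; yes; no; contradiction)
  open import Relation.Unary using (Pred; Decidable)
  open import Relation.Binary.PropositionalEquality
  open import Algebra.Properties.Semiring.Sum ℤP.+-*-semiring
    using (sum-syntax; sum-cong-≗; ∑-distrib-+; sum-replicate-zero)
  open ≡-Reasoning

  𝟙 : ∀ {p} {P : Set p} → Dec P → ℤ
  𝟙 (yes _) = 1ℤ
  𝟙 (no _)  = 0ℤ

  𝟙-cong : ∀ {p q} {P : Set p} {Q : Set q} (P? : Dec P) (Q? : Dec Q) →
    (P → Q) → (Q → P) → 𝟙 P? ≡ 𝟙 Q?
  𝟙-cong (yes _) (yes _) _ _ = refl
  𝟙-cong (yes p) (no ¬q) f _ = contradiction (f p) ¬q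
  𝟙-cong (no ¬p) (yes q) _ g = contradiction (g q) ¬p
  𝟙-cong (no _)  (no _)  _ _ = refl

  sumₗ : ∀ {a} {A : Set a} → List A → (A → ℤ) → ℤ
  sumₗ []       f = 0ℤ
  sumₗ (x ∷ xs) f = f x + sumₗ xs f

  module _ {a} {A : Set a} where

    sumₗ-cong : ∀ (xs : List A) {f g : A → ℤ} → (∀ x → f x ≡ g x) → sumₗ xs f ≡ sumₗ xs g
    sumₗ-cong []       f≗g = refl
    sumₗ-cong (x ∷ xs) f≗g = cong₂ _+_ (f≗g x) (sumₗ-cong xs f≗g)

    *-distribˡ-sumₗ : ∀ c (xs : List A) f → c * sumₗ xs f ≡ sumₗ xs (λ x → c * f x)
    *-distribˡ-sumₗ c []       f = ℤP.*-zeroʳ c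
    *-distribˡ-sumₗ c (x ∷ xs) f =
      trans (ℤP.*-distribˡ-+ c (f x) (sumₗ xs f)) (cong (c * f x +_) (*-distribˡ-sumₗ c xs f))

    *-distribʳ-sumₗ : ∀ c (xs : List A) f → sumₗ xs f * c ≡ sumₗ xs (λ x → f x * c)
    *-distribʳ-sumₗ c xs f = trans (ℤP.*-comm (sumₗ xs f) c)
      (trans (*-distribˡ-sumₗ c xs f) (sumₗ-cong xs (λ x → ℤP.*-comm c (f x))))

    sumₗ-++ : ∀ (xs ys : List A) f → sumₗ (xs ++ ys) f ≡ sumₗ xs f + sumₗ ys f
    sumₗ-++ []       ys f = sym (ℤP.+-identityˡ _)
    sumₗ-++ (x ∷ xs) ys f = trans (cong (f x +_) (sumₗ-++ xs ys f)) (sym (ℤP.+-assoc (f x) _ _))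

    sumₗ-∑-comm : ∀ (xs : List A) {D} (f : A → Fin D → ℤ) →
      sumₗ xs (λ x → ∑[ t < D ] f x t) ≡ ∑[ t < D ] sumₗ xs (λ x → f x t)
    sumₗ-∑-comm []       {D} f = sym (sum-replicate-zero D)
    sumₗ-∑-comm (x ∷ xs) {D} f =
      trans (cong (∑[ t < D ] f x t +_) (sumₗ-∑-comm xs f)) (sym (∑-distrib-+ {D} (f x) _))

    sumₗ-lookup : ∀ (xs : List A) f → sumₗ xs f ≡ ∑[ i < length xs ] f (lookup xs i)
    sumₗ-lookup []       f = refl
    sumₗ-lookup (x ∷ xs) f = cong (f x +_) (sumₗ-lookup xs f)

    length-filter : ∀ {p} {P : Pred A p} (P? : Decidable P) (xs : List A) →
      ⁺ length (filter P? xs) ≡ sumₗ xs (𝟙 ∘ P?)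
    length-filter P? []       = refl
    length-filter P? (x ∷ xs) with P? x
    ... | yes _ = cong (1ℤ +_) (length-filter P? xs)
    ... | no  _ = trans (length-filter P? xs) (sym (ℤP.+-identityˡ _))

  sumₗ-concatMap-map : ∀ {a b c} {A : Set a} {B : Set b} {C : Set c}
    (g : A → B → C) (xs : List A) (ys : List B) f →
    sumₗ (concatMap (λ x → map (g x) ys) xs) f ≡ sumₗ xs (λ x → sumₗ ys (f ∘ g x))
  sumₗ-concatMap-map g []       ys f = refl
  sumₗ-concatMap-map g (x ∷ xs) ys f =
    trans (sumₗ-++ (map (g x) ys) _ f) (cong₂ _+_ (sumₗ-map ys) (sumₗ-concatMap-map g xs ys f))
    where
    sumₗ-map : ∀ zs → sumₗ (map (g x) zs) f ≡ sumₗ zs (f ∘ g x)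
    sumₗ-map []       = refl
    sumₗ-map (z ∷ zs) = cong (f (g x z) +_) (sumₗ-map zs)

  module _ {c ℓ} (K : FiniteField c ℓ) where
    private module F = FiniteField K
    open F using (Carrier; points; elems)

    _≈ᵥ_ : ∀ {n} → Vec Carrier n → Vec Carrier n → Set (c ⊔ ℓ)
    _≈ᵥ_ = Pointwise F._≈_

    _≈ᵥ?_ : ∀ {n} (u w : Vec Carrier n) → Dec (u ≈ᵥ w)
    _≈ᵥ?_ = Pointwise.decidable F._≟F_

    sumₗ-𝟙-absent : ∀ {y} (xs : List Carrier) → All (λ s → ¬ y F.≈ s) xs → (h : Carrier → ℤ) →
      sumₗ xs (λ s → 𝟙 (y F.≟F s) * h s) ≡ 0ℤ
    sumₗ-𝟙-absent []       _                h = refl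
    sumₗ-𝟙-absent {y} (s ∷ xs) (y≉s ∷ absent) h with y F.≟F s
    ... | yes y≈s = contradiction y≈s y≉s
    ... | no  _   = trans (ℤP.+-identityˡ _) (sumₗ-𝟙-absent xs absent h)

    sumₗ-𝟙-unique : ∀ (xs : List Carrier) → AllPairs (λ a b → ¬ a F.≈ b) xs →
      ∀ {y} → Any (y F.≈_) xs →
      (h : Carrier → ℤ) → (∀ {a b} → a F.≈ b → h a ≡ h b) →
      sumₗ xs (λ s → 𝟙 (y F.≟F s) * h s) ≡ h y
    sumₗ-𝟙-unique (x ∷ xs) (x≉xs ∷ _) {y} (here y≈x) h h-resp with y F.≟F x
    ... | no  y≉x = contradiction y≈x y≉x
    ... | yes _   = begin
      1ℤ * h x + sumₗ xs (λ s → 𝟙 (y F.≟F s) * h s)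
        ≡⟨ cong₂ _+_ (ℤP.*-identityˡ (h x))
             (sumₗ-𝟙-absent xs (All.map (λ x≉s y≈s → x≉s (F.trans (F.sym y≈x) y≈s)) x≉xs) h) ⟩
      h x + 0ℤ ≡⟨ ℤP.+-identityʳ (h x) ⟩
      h x      ≡⟨ h-resp (F.sym y≈x) ⟩
      h y      ∎
    sumₗ-𝟙-unique (x ∷ xs) (x≉xs ∷ distinct) {y} (there y∈xs) h h-resp with y F.≟F x
    ... | yes y≈x = contradiction y≈x
                      (All.lookupWith (λ x≉s y≈s y≈x → x≉s (F.trans (F.sym y≈x) y≈s)) x≉xs y∈xs)
    ... | no  _   = trans (ℤP.+-identityˡ _) (sumₗ-𝟙-unique xs distinct y∈xs h h-resp)

    𝟙-∷ : ∀ {n} y (ys : Vec Carrier n) a s →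
      𝟙 ((y ∷ ys) ≈ᵥ? (a ∷ s)) ≡ 𝟙 (y F.≟F a) * 𝟙 (ys ≈ᵥ? s)
    𝟙-∷ y ys a s with y F.≟F a | ys ≈ᵥ? s
    ... | yes _ | yes _ = refl
    ... | yes _ | no  _ = refl
    ... | no  _ | yes _ = refl
    ... | no  _ | no  _ = refl

    sumₗ-points-𝟙 : ∀ n (y : Vec Carrier n) (h : Vec Carrier n → ℤ) →
      (∀ {u w} → u ≈ᵥ w → h u ≡ h w) →
      sumₗ (points n) (λ s → 𝟙 (y ≈ᵥ? s) * h s) ≡ h y
    sumₗ-points-𝟙 zero    []       h h-resp = trans (ℤP.+-identityʳ _) (ℤP.*-identityˡ (h []))
    sumₗ-points-𝟙 (suc n) (y ∷ ys) h h-resp = begin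
      sumₗ (points (suc n)) (λ s → 𝟙 ((y ∷ ys) ≈ᵥ? s) * h s)
        ≡⟨ sumₗ-concatMap-map _∷_ elems (points n) _ ⟩
      sumₗ elems (λ a → sumₗ (points n) (λ s → 𝟙 ((y ∷ ys) ≈ᵥ? (a ∷ s)) * h (a ∷ s)))
        ≡⟨ sumₗ-cong elems (λ a → trans (sumₗ-cong (points n) (split a))
                                        (sym (*-distribˡ-sumₗ (𝟙 (y F.≟F a)) (points n) _))) ⟩
      sumₗ elems (λ a → 𝟙 (y F.≟F a) * sumₗ (points n) (λ s → 𝟙 (ys ≈ᵥ? s) * h (a ∷ s)))
        ≡⟨ sumₗ-cong elems (λ a → cong (𝟙 (y F.≟F a) *_)
             (sumₗ-points-𝟙 n ys (h ∘ (a ∷_)) (λ u≈w → h-resp (F.refl ∷ u≈w)))) ⟩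
      sumₗ elems (λ a → 𝟙 (y F.≟F a) * h (a ∷ ys))
        ≡⟨ sumₗ-𝟙-unique elems F.distinct (F.complete y) (λ a → h (a ∷ ys))
                         (λ a≈b → h-resp (a≈b ∷ Pointwise.refl F.refl)) ⟩
      h (y ∷ ys) ∎
      where
      split : ∀ a s →
        𝟙 ((y ∷ ys) ≈ᵥ? (a ∷ s)) * h (a ∷ s) ≡ 𝟙 (y F.≟F a) * (𝟙 (ys ≈ᵥ? s) * h (a ∷ s))
      split a s = trans (cong (_* h (a ∷ s)) (𝟙-∷ y ys a s))
                        (ℤP.*-assoc (𝟙 (y F.≟F a)) (𝟙 (ys ≈ᵥ? s)) (h (a ∷ s)))

    esyms : ∀ (j : ℕ) {n} → Vec Carrier n → Vec Carrier (suc j)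
    esyms zero    xs = F.1# ∷ []
    esyms (suc j) xs = F.esym (suc j) xs ∷ esyms j xs

    -- σᵢ(a ∷ x) = σᵢ(x) + a σᵢ₋₁(x)
    adjoin : ∀ (j : ℕ) → Carrier → Vec Carrier (suc j) → Vec Carrier (suc j)
    adjoin zero    a (u ∷ [])       = u ∷ []
    adjoin (suc j) a (u ∷ w ∷ rest) = (u F.+ a F.* w) ∷ adjoin j a (w ∷ rest)

    esyms-∷ : ∀ j {n} a (xs : Vec Carrier n) → esyms j (a ∷ xs) ≡ adjoin j a (esyms j xs)
    esyms-∷ zero          a xs = refl
    esyms-∷ (suc zero)    a xs = refl
    esyms-∷ (suc (suc j)) a xs = cong (F.esym (suc (suc j)) (a ∷ xs) ∷_) (esyms-∷ (suc j) a xs)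

    head-esyms : ∀ j {n} (xs : Vec Carrier n) → head (esyms j xs) ≡ F.esym j xs
    head-esyms zero    xs = refl
    head-esyms (suc j) xs = refl

    adjoin-cong : ∀ j a {u w} → u ≈ᵥ w → adjoin j a u ≈ᵥ adjoin j a w
    adjoin-cong zero    a (u≈w ∷ [])           = u≈w ∷ []
    adjoin-cong (suc j) a (u≈w ∷ u′≈w′ ∷ rest) =
      F.+-cong u≈w (F.*-cong F.refl u′≈w′) ∷ adjoin-cong j a (u′≈w′ ∷ rest)

    pow-cong : ∀ {x y} n → x F.≈ y → F.pow x n F.≈ F.pow y n
    pow-cong zero    x≈y = F.refl
    pow-cong (suc n) x≈y = F.*-cong x≈y (pow-cong n x≈y)

    trace-cong : ∀ p j {x y} → x F.≈ y → F.trace p j x F.≈ F.trace p j y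
    trace-cong p zero    x≈y = F.refl
    trace-cong p (suc j) x≈y = F.+-cong (trace-cong p j x≈y) (pow-cong (p ℕ.^ j) x≈y)

    module Census (k : ℕ) where

      D : ℕ
      D = length (points (suc k))

      state : Fin D → Vec Carrier (suc k)
      state = lookup (points (suc k))

      census : ℕ → Fin D → ℤ
      census n t = sumₗ (points n) (λ x → 𝟙 (esyms k x ≈ᵥ? state t))

      transition : Fin D → Fin D → ℤ
      transition t s = sumₗ elems (λ a → 𝟙 (adjoin k a (state s) ≈ᵥ? state t))

      decompose-by-state : ∀ {n} (x : Vec Carrier n) (h : Vec Carrier (suc k) → ℤ) →
        (∀ {u w} → u ≈ᵥ w → h u ≡ h w) →
        h (esyms k x) ≡ ∑[ t < D ] (𝟙 (esyms k x ≈ᵥ? state t) * h (state t))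
      decompose-by-state x h h-resp =
        trans (sym (sumₗ-points-𝟙 (suc k) (esyms k x) h h-resp)) (sumₗ-lookup (points (suc k)) _)

      census-suc : ∀ n t → census (suc n) t ≡ ∑[ s < D ] (transition t s * census n s)
      census-suc n t = begin
        sumₗ (points (suc n)) (λ x → 𝟙 (esyms k x ≈ᵥ? state t))
          ≡⟨ sumₗ-concatMap-map _∷_ elems (points n) _ ⟩
        sumₗ elems (λ a → sumₗ (points n) (λ x → 𝟙 (esyms k (a ∷ x) ≈ᵥ? state t)))
          ≡⟨ sumₗ-cong elems (λ a → sumₗ-cong (points n) (λ x →
               trans (cong (λ u → 𝟙 (u ≈ᵥ? state t)) (esyms-∷ k a x)) (decompose-by-state x (step a) (step-resp a)))) ⟩
        sumₗ elems (λ a → sumₗ (points n) (λ x → ∑[ s < D ] (𝟙 (esyms k x ≈ᵥ? state s) * step a (state s))))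
          ≡⟨ sumₗ-cong elems (λ a → sumₗ-∑-comm (points n) {D} _) ⟩
        sumₗ elems (λ a → ∑[ s < D ] sumₗ (points n) (λ x → 𝟙 (esyms k x ≈ᵥ? state s) * step a (state s)))
          ≡⟨ sumₗ-∑-comm elems {D} _ ⟩
        ∑[ s < D ] sumₗ elems (λ a → sumₗ (points n) (λ x → 𝟙 (esyms k x ≈ᵥ? state s) * step a (state s)))
          ≡⟨ sum-cong-≗ {D} (λ s → sumₗ-cong elems (λ a →
               trans (sym (*-distribʳ-sumₗ (step a (state s)) (points n) (λ x → 𝟙 (esyms k x ≈ᵥ? state s))))
                     (ℤP.*-comm (census n s) (step a (state s))))) ⟩
        ∑[ s < D ] sumₗ elems (λ a → step a (state s) * census n s)
          ≡⟨ sum-cong-≗ {D} (λ s → sym (*-distribʳ-sumₗ (census n s) elems _)) ⟩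
        ∑[ s < D ] (transition t s * census n s) ∎
        where
        step : Carrier → Vec Carrier (suc k) → ℤ
        step a u = 𝟙 (adjoin k a u ≈ᵥ? state t)
        step-resp : ∀ a {u w} → u ≈ᵥ w → step a u ≡ step a w
        step-resp a u≈w = 𝟙-cong (_ ≈ᵥ? state t) (_ ≈ᵥ? state t)
          (Pointwise.trans F.trans (adjoin-cong k a (Pointwise.sym F.sym u≈w)))
          (Pointwise.trans F.trans (adjoin-cong k a u≈w))

      traceIs : ℕ → ℕ → ℕ → Fin D → ℤ
      traceIs p r m t = 𝟙 (F.trace p r (head (state t)) F.≟F F.fromℕ m)

      countTr-census : ∀ p r m n →
        ⁺ F.countTr p r n (F.esym k) m ≡ ∑[ t < D ] (traceIs p r m t * census n t)
      countTr-census p r m n = begin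
        ⁺ F.countTr p r n (F.esym k) m
          ≡⟨ length-filter (λ x → F.trace p r (F.esym k x) F.≟F F.fromℕ m) (points n) ⟩
        sumₗ (points n) (λ x → 𝟙 (F.trace p r (F.esym k x) F.≟F F.fromℕ m))
          ≡⟨ sumₗ-cong (points n) (λ x →
               trans (cong (λ y → 𝟙 (F.trace p r y F.≟F F.fromℕ m)) (sym (head-esyms k x)))
                     (decompose-by-state x hasTrace hasTrace-resp)) ⟩
        sumₗ (points n) (λ x → ∑[ t < D ] (𝟙 (esyms k x ≈ᵥ? state t) * traceIs p r m t))
          ≡⟨ sumₗ-∑-comm (points n) {D} _ ⟩
        ∑[ t < D ] sumₗ (points n) (λ x → 𝟙 (esyms k x ≈ᵥ? state t) * traceIs p r m t)
          ≡⟨ sum-cong-≗ {D} (λ t → trans (sym (*-distribʳ-sumₗ (traceIs p r m t) (points n) _))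
                                         (ℤP.*-comm (census n t) (traceIs p r m t))) ⟩
        ∑[ t < D ] (traceIs p r m t * census n t) ∎
        where
        hasTrace : Vec Carrier (suc k) → ℤ
        hasTrace u = 𝟙 (F.trace p r (head u) F.≟F F.fromℕ m)
        hasTrace-resp : ∀ {u w} → u ≈ᵥ w → hasTrace u ≡ hasTrace w
        hasTrace-resp (u₀≈w₀ ∷ _) = 𝟙-cong (_ F.≟F F.fromℕ m) (_ F.≟F F.fromℕ m)
          (F.trans (trace-cong p r (F.sym u₀≈w₀))) (F.trans (trace-cong p r u₀≈w₀))

      countTr-annihilated : ∀ p r → ∃ λ j → Σ (ℕ → ℤ) λ a → a j ≢ 0ℤ ×
        ∀ m → Annihilates j a (λ n → ⁺ F.countTr p r n (F.esym k) m)
      countTr-annihilated p r =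
        let j , a , aⱼ≢0 , ann = orbit-annihilated transition census census-suc in
        j , a , aⱼ≢0 , λ m n →
          trans (sum-cong-≗ {suc j} λ i → cong (a (toℕ i) *_) (countTr-census p r m (n ℕ.+ toℕ i)))
                (ann (traceIs p r m) n)

module CyclotomicForm where

  open OrbitRecurrence
  open import Defs
  open import Data.Nat as ℕ using (ℕ; zero; suc; _≡ᵇ_; _%_)
  import Data.Nat.DivMod as ℕ
  open import Data.Integer as ℤ using (ℤ; 0ℤ; -_)
  import Data.Integer.Properties as ℤP
  open import Data.Integer.GCD using (gcd)
  open import Data.Integer.Tactic.RingSolver using (solve-∀)
  open import Data.Rational as ℚ using (ℚ; 0ℚ; 1ℚ; 1/_)
  import Data.Rational.Properties as ℚP
  import Data.Rational.Unnormalised as ℚᵘ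
  import Data.Rational.Unnormalised.Properties as ℚᵘP
  open import Data.Fin using (Fin; zero; suc; toℕ)
  import Data.Fin.Properties as FinP
  open import Data.Bool using (true; false; if_then_else_)
  open import Data.List using ([]; _∷_; foldr; tabulate; allFin)
  open import Function using (_∘_; id)
  open import Relation.Binary.PropositionalEquality
  open import Algebra.Bundles using (CommutativeRing)
  open import Algebra.Properties.Semiring.Sum ℤP.+-*-semiring using (sum-cong-≗; *-distribˡ-sum)
  open import Algebra.Properties.Semiring.Sum (CommutativeRing.semiring ℚP.+-*-commutativeRing)
    using ()
    renaming ( sum to ∑ℚ; sum-cong-≗ to ∑ℚ-cong; sum-replicate-zero to ∑ℚ-zero
             ; *-distribˡ-sum to *-distribˡ-∑ℚ)
  open ≡-Reasoning

  ι : ℤ → ℚ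
  ι a = a ℚ./ 1

  toℚᵘ-ι : ∀ a → ℚ.toℚᵘ (ι a) ℚᵘ.≃ ℚᵘ.mkℚᵘ a 0
  toℚᵘ-ι a = ℚP.toℚᵘ-fromℚᵘ (ℚᵘ.mkℚᵘ a 0)

  ι-+ : ∀ a b → ι (a ℤ.+ b) ≡ ι a ℚ.+ ι b
  ι-+ a b = ℚP.toℚᵘ-injective
    (ℚᵘP.≃-trans (toℚᵘ-ι (a ℤ.+ b)) (ℚᵘP.≃-trans (ℚᵘ.*≡* (scale a b)) (ℚᵘP.≃-sym
      (ℚᵘP.≃-trans (ℚP.toℚᵘ-homo-+ (ι a) (ι b)) (ℚᵘP.+-cong (toℚᵘ-ι a) (toℚᵘ-ι b))))))
    where
    scale : ∀ a b → (a ℤ.+ b) ℤ.* ℤ.+ 1 ≡ (a ℤ.* ℤ.+ 1 ℤ.+ b ℤ.* ℤ.+ 1) ℤ.* ℤ.+ 1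
    scale = solve-∀

  ι-* : ∀ a b → ι (a ℤ.* b) ≡ ι a ℚ.* ι b
  ι-* a b = ℚP.toℚᵘ-injective
    (ℚᵘP.≃-trans (toℚᵘ-ι (a ℤ.* b)) (ℚᵘP.≃-sym
      (ℚᵘP.≃-trans (ℚP.toℚᵘ-homo-* (ι a) (ι b)) (ℚᵘP.*-cong (toℚᵘ-ι a) (toℚᵘ-ι b)))))

  ι-sumTo : ∀ n f → ι (sumTo n f) ≡ ∑ℚ (λ (i : Fin n) → ι (f (toℕ i)))
  ι-sumTo zero    f = refl
  ι-sumTo (suc n) f = trans (ι-+ (f 0) (sumTo n (f ∘ suc))) (cong (ι (f 0) ℚ.+_) (ι-sumTo n (f ∘ suc)))

  ι-≢0 : ∀ {a} → a ≢ 0ℤ → ι a ≢ 0ℚ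
  ι-≢0 {a} a≢0 ιa≡0 = a≢0 (begin
    a                            ≡⟨ ℚP.↥-/ a 1 ⟨
    ℚ.↥ (ι a) ℤ.* gcd a (ℤ.+ 1)  ≡⟨ cong (ℤ._* gcd a (ℤ.+ 1)) (ℚP.p≡0⇒↥p≡0 (ι a) ιa≡0) ⟩
    0ℤ ℤ.* gcd a (ℤ.+ 1)         ≡⟨ ℤP.*-zeroˡ (gcd a (ℤ.+ 1)) ⟩
    0ℤ                           ∎)

  leading-term : ∀ j (a x : ℕ → ℤ) → Annihilates j a x →
    ∀ n → a j ℤ.* x (n ℕ.+ j) ≡ sumTo j (λ i → - a i ℤ.* x (n ℕ.+ i))
  leading-term j a x ann n = begin
    a j ℤ.* x (n ℕ.+ j)              ≡⟨ isolate (sumTo j term) (a j ℤ.* x (n ℕ.+ j)) ⟩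
    (sumTo j term ℤ.+ a j ℤ.* x (n ℕ.+ j)) ℤ.- sumTo j term
                                     ≡⟨ cong (ℤ._- sumTo j term) (trans (sym (sumTo-suc j term)) (ann n)) ⟩
    0ℤ ℤ.- sumTo j term              ≡⟨ ℤP.+-identityˡ (- sumTo j term) ⟩
    - sumTo j term                   ≡⟨ ℤP.-1*i≡-i (sumTo j term) ⟨
    ℤ.-1ℤ ℤ.* sumTo j term           ≡⟨ *-distribˡ-sum {j} ℤ.-1ℤ (term ∘ toℕ) ⟩
    sumTo j (λ i → ℤ.-1ℤ ℤ.* term i) ≡⟨ sum-cong-≗ {j} (λ i → negate (a (toℕ i)) _) ⟩
    sumTo j (λ i → - a i ℤ.* x (n ℕ.+ i)) ∎
    where
    term : ℕ → ℤ
    term i = a i ℤ.* x (n ℕ.+ i)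
    isolate : ∀ s t → t ≡ (s ℤ.+ t) ℤ.- s
    isolate = solve-∀
    negate : ∀ b y → ℤ.-1ℤ ℤ.* (b ℤ.* y) ≡ - b ℤ.* y
    negate = solve-∀

  module _ (j : ℕ) (a : ℕ → ℤ) (aⱼ≢0 : a j ≢ 0ℤ) where

    private instance
      ιaⱼ-nonZero : ℚ.NonZero (ι (a j))
      ιaⱼ-nonZero = ℚ.≢-nonZero (ι-≢0 aⱼ≢0)

    monicCoeff : ℕ → ℚ
    monicCoeff i = ι (- a i) ℚ.* 1/ ι (a j)

    monic-recurrence : ∀ {x} → Annihilates j a x → ∀ n →
      ι (x (n ℕ.+ j)) ≡ ∑ℚ (λ (i : Fin j) → monicCoeff (toℕ i) ℚ.* ι (x (n ℕ.+ toℕ i)))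
    monic-recurrence {x} ann n = begin
      ι xⱼ                                  ≡⟨ ℚP.*-identityˡ (ι xⱼ) ⟨
      1ℚ ℚ.* ι xⱼ                           ≡⟨ cong (ℚ._* ι xⱼ) (ℚP.*-inverseˡ (ι (a j))) ⟨
      inv ℚ.* ι (a j) ℚ.* ι xⱼ              ≡⟨ ℚP.*-assoc inv (ι (a j)) (ι xⱼ) ⟩
      inv ℚ.* (ι (a j) ℚ.* ι xⱼ)            ≡⟨ cong (inv ℚ.*_) (ι-* (a j) xⱼ) ⟨
      inv ℚ.* ι (a j ℤ.* xⱼ)                ≡⟨ cong (λ y → inv ℚ.* ι y) (leading-term j a x ann n) ⟩
      inv ℚ.* ι (sumTo j term)              ≡⟨ cong (inv ℚ.*_) (ι-sumTo j term) ⟩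
      inv ℚ.* ∑ℚ (λ (i : Fin j) → ι (term (toℕ i)))
                                            ≡⟨ *-distribˡ-∑ℚ {j} inv _ ⟩
      ∑ℚ (λ (i : Fin j) → inv ℚ.* ι (term (toℕ i)))
                                            ≡⟨ ∑ℚ-cong {j} (scale ∘ toℕ) ⟩
      ∑ℚ (λ (i : Fin j) → monicCoeff (toℕ i) ℚ.* ι (x (n ℕ.+ toℕ i))) ∎
      where
      inv : ℚ
      inv = 1/ ι (a j)
      xⱼ : ℤ
      xⱼ = x (n ℕ.+ j)
      term : ℕ → ℤ
      term i = - a i ℤ.* x (n ℕ.+ i)
      scale : ∀ i → inv ℚ.* ι (term i) ≡ monicCoeff i ℚ.* ι (x (n ℕ.+ i))
      scale i = begin
        inv ℚ.* ι (- a i ℤ.* x (n ℕ.+ i))         ≡⟨ cong (inv ℚ.*_) (ι-* (- a i) (x (n ℕ.+ i))) ⟩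
        inv ℚ.* (ι (- a i) ℚ.* ι (x (n ℕ.+ i)))   ≡⟨ ℚP.*-assoc inv _ _ ⟨
        inv ℚ.* ι (- a i) ℚ.* ι (x (n ℕ.+ i))     ≡⟨ cong (ℚ._* ι (x (n ℕ.+ i))) (ℚP.*-comm inv (ι (- a i))) ⟩
        monicCoeff i ℚ.* ι (x (n ℕ.+ i))          ∎

  constC : ∀ {p} → ℚ → Cyc (suc p)
  constC c zero    = c
  constC c (suc _) = 0ℚ

  foldr-tabulate : ∀ n {X : Set} (f : X → ℚ) (g : Fin n → X) →
    foldr (λ x acc → f x ℚ.+ acc) 0ℚ (tabulate g) ≡ ∑ℚ (f ∘ g)
  foldr-tabulate zero    f g = refl
  foldr-tabulate (suc n) f g = cong (f (g zero) ℚ.+_) (foldr-tabulate n f (g ∘ suc))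

  foldr-+C : ∀ {p} {X : Set} (f : X → Cyc p) xs m →
    foldr (λ x acc → f x +C acc) zeroC xs m ≡ foldr (λ x acc → f x m ℚ.+ acc) 0ℚ xs
  foldr-+C f []       m = refl
  foldr-+C f (x ∷ xs) m = cong (f x m ℚ.+_) (foldr-+C f xs m)

  sumFin≡∑ℚ : ∀ {p} (f : Fin p → ℚ) → sumFin f ≡ ∑ℚ f
  sumFin≡∑ℚ {p} f = foldr-tabulate p f id

  sumC-apply : ∀ {p d} (f : Fin d → Cyc p) m → sumC f m ≡ ∑ℚ (λ i → f i m)
  sumC-apply {d = d} f m = trans (foldr-+C f (allFin d) m) (foldr-tabulate d (λ i → f i m) id)

  ∑ℚ-delta : ∀ {n} (g : Fin n → ℚ) m → ∑ℚ (λ i → if toℕ i ≡ᵇ toℕ m then g i else 0ℚ) ≡ g m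
  ∑ℚ-delta {suc n} g zero    = trans (cong (g zero ℚ.+_) (∑ℚ-zero n)) (ℚP.+-identityʳ (g zero))
  ∑ℚ-delta {suc n} g (suc m) = trans (ℚP.+-identityˡ _) (∑ℚ-delta (g ∘ suc) m)

  if-0* : ∀ b y → (if b then 0ℚ ℚ.* y else 0ℚ) ≡ 0ℚ
  if-0* true  y = ℚP.*-zeroˡ y
  if-0* false y = refl

  mulC-constC : ∀ p c (b : Cyc (suc p)) m → mulC (suc p) (constC c) b m ≡ c ℚ.* b m
  mulC-constC p c b m = begin
    sumFin (λ i → sumFin (term i))
      ≡⟨ sumFin≡∑ℚ (λ i → sumFin (term i)) ⟩
    sumFin (term zero) ℚ.+ ∑ℚ (λ i → sumFin (term (suc i)))
      ≡⟨ cong₂ ℚ._+_ (sumFin≡∑ℚ (term zero))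
                     (∑ℚ-≡0 (λ i → trans (sumFin≡∑ℚ (term (suc i))) (∑ℚ-≡0 (term-suc≡0 i)))) ⟩
    ∑ℚ (term zero) ℚ.+ 0ℚ
      ≡⟨ ℚP.+-identityʳ _ ⟩
    ∑ℚ (term zero)
      ≡⟨ ∑ℚ-cong {suc p} (λ j → cong (λ l → if l ≡ᵇ toℕ m then c ℚ.* b j else 0ℚ)
                                     (ℕ.m<n⇒m%n≡m (FinP.toℕ<n j))) ⟩
    ∑ℚ (λ j → if toℕ j ≡ᵇ toℕ m then c ℚ.* b j else 0ℚ)
      ≡⟨ ∑ℚ-delta (λ j → c ℚ.* b j) m ⟩
    c ℚ.* b m ∎
    where
    term : Fin (suc p) → Fin (suc p) → ℚ
    term i j = if ((toℕ i ℕ.+ toℕ j) % suc p) ≡ᵇ toℕ m then constC c i ℚ.* b j else 0ℚ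
    term-suc≡0 : ∀ i j → term (suc i) j ≡ 0ℚ
    term-suc≡0 i j = if-0* (((suc (toℕ i) ℕ.+ toℕ j) % suc p) ≡ᵇ toℕ m) (b j)
    ∑ℚ-≡0 : ∀ {n} {f : Fin n → ℚ} → (∀ i → f i ≡ 0ℚ) → ∑ℚ f ≡ 0ℚ
    ∑ℚ-≡0 {n} f≡0 = trans (∑ℚ-cong {n} f≡0) (∑ℚ-zero n)

  sumC-scale : ∀ {p d} (c : Fin d → ℚ) (b : Fin d → Cyc (suc p)) m →
    sumC (λ i → mulC (suc p) (constC (c i)) (b i)) m ≡ ∑ℚ (λ i → c i ℚ.* b i m)
  sumC-scale {p} {d} c b m = trans (sumC-apply (λ i → mulC (suc p) (constC (c i)) (b i)) m)
    (∑ℚ-cong {d} (λ i → mulC-constC p (c i) (b i) m))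

open import Defs
open import Data.Nat using (ℕ; suc; _+_; _^_; _≤_; NonZero)
open import Data.Nat.Primality using (Prime)
open import Data.Fin using (Fin; toℕ)
open import Data.Product using (∃; Σ; _,_)
open import Function using (_∘_)
open import Relation.Binary.PropositionalEquality
open import Algebra.Bundles using (CommutativeRing)
open import Data.Integer using (ℤ; +_)
import Data.Rational.Properties as ℚP
open import Data.Rational as ℚ using (ℚ; 0ℚ)
open import Algebra.Properties.Semiring.Sum (CommutativeRing.semiring ℚP.+-*-commutativeRing)
  using () renaming (sum to ∑ℚ)
open ≡-Reasoning
open PointCensus using (module Census)
open CyclotomicForm

-- The recurrence holds for all n and every finite field.
theorem4p1 : ∀ {c ℓ} (K : FiniteField c ℓ) (p r k : ℕ) .{{_ : NonZero p}} →
    Prime p → 1 ≤ r → FiniteField.card K ≡ p ^ r → 2 ≤ k →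
    ∃ λ (d : ℕ) → Σ (Fin d → Cyc p) λ coef →
      ∀ n → k ≤ n →
        Sσ K p r k (n + d) ≃C sumC (λ i → mulC p (coef i) (Sσ K p r k (n + toℕ i)))
theorem4p1 K (suc p) r k _ _ _ _ =
  let j , a , aⱼ≢0 , ann = Census.countTr-annihilated K k (suc p) r
      coeff : Fin j → ℚ
      coeff i = monicCoeff j a aⱼ≢0 (toℕ i)
      count : ℕ → ℕ → ℤ
      count m n = + FiniteField.countTr K (suc p) r n (FiniteField.esym K k) m
      S : ℕ → Cyc (suc p)
      S = Sσ K (suc p) r k
  in j , constC ∘ coeff , λ n _ → 0ℚ , λ m → begin
    S (n + j) m
      ≡⟨ monic-recurrence j a aⱼ≢0 {count (toℕ m)} (ann (toℕ m)) n ⟩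
    ∑ℚ (λ i → coeff i ℚ.* S (n + toℕ i) m)
      ≡⟨ sumC-scale coeff (λ i → S (n + toℕ i)) m ⟨
    sumC (λ i → mulC (suc p) (constC (coeff i)) (S (n + toℕ i))) m
      ≡⟨ ℚP.+-identityʳ _ ⟨
    sumC (λ i → mulC (suc p) (constC (coeff i)) (S (n + toℕ i))) m ℚ.+ 0ℚ ∎
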